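{- $W(14,3) > 669{,}256{,}082$. Equivalently, there exists a coloring of $\{0,1,\ldots,669{,}256{,}081\}$ with $3$ colors containing no monochromatic arithmetic progression of length $14$.
   Context: For integers $k\ge 3$ and $r\ge 2$, the van der Waerden number $W(k,r)$ is the least positive integer $N$ such that every coloring of $\{0,1,\ldots,N-1\}$ with $r$ colors contains a monochromatic arithmetic progression of length $k$, i.e. integers $a, a+d, \ldots, a+(k-1)d$ with $d\ge 1$, all in the set and all of the same color. Thus $W(k,r)>n$ means there is an $r$-coloring of $\{0,\ldots,n-1\}$ with no monochromatic $k$-term arithmetic progression. -}

module Defs where

open import Data.Nat using (ℕ; zero; suc; _+_; _*_; _<_; _≤_)
open import Data.Fin using (Fin)
open import Data.Product using (Σ; _×_; ∃)
open import Relation.Binary.PropositionalEquality using (_≡_)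
open import Relation.Nullary using (¬_)

Coloring : ℕ → ℕ → Set
Coloring n r = Fin n → Fin r

MonoAP : ∀ {n r} → Coloring n r → ℕ → Set
MonoAP {n} {r} c k =
  Σ ℕ λ a → Σ ℕ λ d → (1 ≤ d) × Σ (Fin r) λ col →
    (i : Fin k) →
      Σ (a + Data.Fin.toℕ i * d < n) λ lt →
        c (Data.Fin.fromℕ< lt) ≡ col

WGreater : ℕ → ℕ → ℕ → Set
WGreater k r n = Σ (Coloring n r) λ c → ¬ MonoAP c k

{-# OPTIONS --safe #-}
-- Rabung's construction. Let p = 51481237, a prime ≡ 1 (mod 3). A unit x modulo p is coloured by
-- its cubic residue character χ(x) = x^((p-1)/3) ∈ {1, ω, ω²}; 0 and the other multiples of p get
-- different colours. Scaling a progression a + j d with p ∤ d by d⁻¹ turns it into a run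
-- u, u + 1, …, u + 13 of consecutive residues and permutes the character classes, so the
-- colouring of {0, …, 13 p} has no monochromatic 14-term progression once every run of 14
-- consecutive residues contains two units with different characters; when p ∣ d the progression
-- must be 0, p, …, 13 p. The condition on runs is verified by computation for the runs starting
-- below p / 2 and follows for the others from χ(-1) = 1. That χ takes only three values is proved
-- by induction: p = q y + r gives χ(y) = χ(r) χ(q)⁻¹, so it suffices to compute χ on [1, √p].
module Submission where

open import Algebra.Properties.CommutativeSemigroup using (interchange; x∙yz≈y∙zx)
open import Data.Bool using (Bool; true; false; T; not; _∧_; if_then_else_)
open import Data.Bool.Properties using (T-∧; T-≡)
open import Data.Empty using (⊥)
open import Data.Fin using (Fin; toℕ; fromℕ<)
open import Data.Fin.Patterns using (0F; 1F; 2F; 3F)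
open import Data.Fin.Properties using (toℕ-fromℕ<)
import Data.Fin.Properties as Fin
open import Data.List using (List; []; _∷_; foldl; lookup)
open import Data.List.Membership.Propositional using (_∈_)
open import Data.List.Relation.Unary.All as All using (All; all?)
open import Data.List.Relation.Unary.Any using (here; there)
open import Data.Nat
open import Data.Nat.Coprimality using (prime⇒coprime; coprime-Bézout)
open import Data.Nat.DivMod
open import Data.Nat.Divisibility
open import Data.Nat.GCD using (module Bézout)
open import Data.Nat.Induction using (<-rec)
open import Data.Nat.Primality
open import Data.Nat.Properties
open import Data.Nat.Tactic.RingSolver using (solve-∀)
open import Data.List.Membership.DecPropositional _≟_ using (_∈?_)
open import Data.Product using (∃; _,_; _×_; proj₁; proj₂)
open import Data.Sum using (_⊎_; inj₁; inj₂; [_,_]′)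
open import Function using (it; Equivalence; _∘_)
open import Relation.Binary using (Setoid; IsEquivalence)
open import Relation.Binary.PropositionalEquality
import Relation.Binary.Reasoning.Setoid as ≈-Reasoning
open import Relation.Nullary using (¬_; Dec; yes; no; does; ¬?; contradiction; recompute)
open import Relation.Nullary.Decidable using (map′; from-yes; from-no; _→-dec_)

open import Defs

^-distribʳ-* : ∀ a b e → (a * b) ^ e ≡ a ^ e * b ^ e
^-distribʳ-* a b zero    = refl
^-distribʳ-* a b (suc e) =
  trans (cong (a * b *_) (^-distribʳ-* a b e)) (interchange *-commutativeSemigroup a b (a ^ e) (b ^ e))

-- Most significant digit first.
fromBase4 : List (Fin 4) → ℕ
fromBase4 = foldl (λ e d → 4 * e + toℕ d) 0

trialDivision⇒rough : ∀ {m n} → (∀ {d} → d < m → NonTrivial d → d ∤ n) → m Rough n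
trialDivision⇒rough upTo (hasNonTrivialDivisor {d} d<m d∣n) =
  upTo d<m (recompute (nonTrivial? d) it) d∣n

progression-squeeze : ∀ m {a d n} → a + suc m * d ≤ suc m * n → n ≤ d → a ≡ 0 × d ≡ n
progression-squeeze m {a} {d} {n} a+kd≤kn n≤d =
  n≤0⇒n≡0 (+-cancelʳ-≤ (suc m * d) a 0 (≤-trans a+kd≤kn (*-monoʳ-≤ (suc m) n≤d))) ,
  ≤-antisym (*-cancelˡ-≤ (suc m) (m+n≤o⇒n≤o a a+kd≤kn)) n≤d

T-does : ∀ {A : Set} (a? : Dec A) → T (does a?) → A
T-does (yes a) _ = a

T-not-does : ∀ {A : Set} (a? : Dec A) → T (not (does a?)) → ¬ A
T-not-does (no ¬a) _ = ¬a

T-if : ∀ b {x y} → T (if b then x else y) → (T b × T x) ⊎ (T (not b) × T y)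
T-if true  Tx = inj₁ (_ , Tx)
T-if false Ty = inj₂ (_ , Ty)

module Modulo (n : ℕ) ⦃ _ : NonZero n ⦄ where

  infix 4 _≈_ _≈?_
  record _≈_ (a b : ℕ) : Set where
    constructor mod-≡
    field %-≡ : a % n ≡ b % n
  open _≈_ public

  ≈-isEquivalence : IsEquivalence _≈_
  ≈-isEquivalence = record
    { refl  = mod-≡ refl
    ; sym   = λ (mod-≡ e) → mod-≡ (sym e)
    ; trans = λ (mod-≡ e) (mod-≡ f) → mod-≡ (trans e f)
    }

  ≈-setoid : Setoid _ _
  ≈-setoid = record { isEquivalence = ≈-isEquivalence }

  open IsEquivalence ≈-isEquivalence public
    renaming (refl to ≈-refl; sym to ≈-sym; trans to ≈-trans; reflexive to ≈-reflexive)

  _≈?_ : ∀ a b → Dec (a ≈ b)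
  a ≈? b = map′ mod-≡ %-≡ (a % n ≟ b % n)

  m%n≈m : ∀ a → a % n ≈ a
  m%n≈m a = mod-≡ (m%n%n≡m%n a n)

  ≈⇒≡ : ∀ {a b} → a < n → b < n → a ≈ b → a ≡ b
  ≈⇒≡ a<n b<n (mod-≡ e) = trans (sym (m<n⇒m%n≡m a<n)) (trans e (m<n⇒m%n≡m b<n))

  +-cong : ∀ {a b c d} → a ≈ b → c ≈ d → a + c ≈ b + d
  +-cong {a} {b} {c} {d} (mod-≡ e) (mod-≡ f) = mod-≡ (begin
    (a + c) % n          ≡⟨ %-distribˡ-+ a c n ⟩
    (a % n + c % n) % n  ≡⟨ cong₂ (λ x y → (x + y) % n) e f ⟩
    (b % n + d % n) % n  ≡⟨ %-distribˡ-+ b d n ⟨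
    (b + d) % n          ∎)
    where open ≡-Reasoning

  *-cong : ∀ {a b c d} → a ≈ b → c ≈ d → a * c ≈ b * d
  *-cong {a} {b} {c} {d} (mod-≡ e) (mod-≡ f) = mod-≡ (begin
    (a * c) % n            ≡⟨ %-distribˡ-* a c n ⟩
    (a % n * (c % n)) % n  ≡⟨ cong₂ (λ x y → (x * y) % n) e f ⟩
    (b % n * (d % n)) % n  ≡⟨ %-distribˡ-* b d n ⟨
    (b * d) % n            ∎)
    where open ≡-Reasoning

  ^-cong : ∀ {a b} e → a ≈ b → a ^ e ≈ b ^ e
  ^-cong zero    a≈b = ≈-refl
  ^-cong (suc e) a≈b = *-cong a≈b (^-cong e a≈b)

  private
    0%n≡0 : 0 % n ≡ 0
    0%n≡0 = m<n⇒m%n≡m (>-nonZero⁻¹ n)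

  ∣⇒≈0 : ∀ {a} → n ∣ a → a ≈ 0
  ∣⇒≈0 {a} n∣a = mod-≡ (trans (n∣m⇒m%n≡0 a n n∣a) (sym 0%n≡0))

  ≈0⇒∣ : ∀ {a} → a ≈ 0 → n ∣ a
  ≈0⇒∣ {a} (mod-≡ e) = m%n≡0⇒n∣m a n (trans e 0%n≡0)

  ∣-resp-≈ : ∀ {a b} → a ≈ b → n ∣ a → n ∣ b
  ∣-resp-≈ a≈b n∣a = ≈0⇒∣ (≈-trans (≈-sym a≈b) (∣⇒≈0 n∣a))

  -- n ∸ 1 represents -1.
  ≈-negate : ∀ {a b} → a + b ≈ 0 → a ≈ (n ∸ 1) * b
  ≈-negate {a} {b} a+b≈0 = begin
    a                      ≡⟨ +-identityʳ a ⟨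
    a + 0                  ≈⟨ +-cong ≈-refl (∣⇒≈0 (m∣m*n b)) ⟨
    a + n * b              ≡⟨ cong (λ m → a + m * b) (m+[n∸m]≡n (>-nonZero⁻¹ n)) ⟨
    a + (b + (n ∸ 1) * b)  ≡⟨ +-assoc a b _ ⟨
    a + b + (n ∸ 1) * b    ≈⟨ +-cong a+b≈0 ≈-refl ⟩
    (n ∸ 1) * b            ∎
    where open ≈-Reasoning ≈-setoid

  ∤⇒∃-inverse : Prime n → ∀ {d} → n ∤ d → ∃ λ e → d * e ≈ 1
  ∤⇒∃-inverse n-prime {d} n∤d with coprime-Bézout (prime⇒coprime n-prime ⦃ d%n≢0 ⦄ (m%n<n d n))
    where d%n≢0 = ≢-nonZero (n∤d ∘ m%n≡0⇒n∣m d n)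
  ... | Bézout.-+ x y 1+xn≡yD = y , (begin
    d * y        ≈⟨ *-cong (m%n≈m d) ≈-refl ⟨
    d % n * y    ≡⟨ *-comm (d % n) y ⟩
    y * (d % n)  ≡⟨ 1+xn≡yD ⟨
    1 + x * n    ≈⟨ +-cong ≈-refl (∣⇒≈0 (n∣m*n x)) ⟩
    1 + 0        ∎)
    where open ≈-Reasoning ≈-setoid
  ... | Bézout.+- x y 1+yD≡xn = (n ∸ 1) * y , (begin
    d * ((n ∸ 1) * y)        ≈⟨ *-cong (m%n≈m d) ≈-refl ⟨
    d % n * ((n ∸ 1) * y)    ≡⟨ x∙yz≈y∙zx *-commutativeSemigroup (d % n) (n ∸ 1) y ⟩
    (n ∸ 1) * (y * (d % n))  ≈⟨ ≈-negate (∣⇒≈0 (subst (n ∣_) (sym 1+yD≡xn) (n∣m*n x))) ⟨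
    1                        ∎)
    where open ≈-Reasoning ≈-setoid

  private
    square : ℕ → ℕ
    square a = a * a

    digitPower : (b¹ b² b³ : ℕ) → Fin 4 → ℕ
    digitPower b¹ b² b³ 0F = 1
    digitPower b¹ b² b³ 1F = b¹
    digitPower b¹ b² b³ 2F = b²
    digitPower b¹ b² b³ 3F = b³

    loop : (b¹ b² b³ : ℕ) → List (Fin 4) → ℕ → ℕ
    loop b¹ b² b³ []       acc = acc
    loop b¹ b² b³ (d ∷ ds) acc = loop b¹ b² b³ ds (square (square acc) * digitPower b¹ b² b³ d % n)

    withCube : List (Fin 4) → (b¹ b² : ℕ) → ℕ
    withCube ds b¹ b² = loop b¹ b² (b² * b¹ % n) ds (1 % n)

    withSquare : List (Fin 4) → ℕ → ℕ
    withSquare ds b¹ = withCube ds b¹ (b¹ * b¹ % n)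

  -- Left-to-right exponentiation in base 4; the small powers of the base are passed as
  -- arguments so that evaluation shares them.
  powMod : List (Fin 4) → ℕ → ℕ
  powMod ds b = withSquare ds (b % n)

  private
    loop-< : ∀ b¹ b² b³ ds {acc} → acc < n → loop b¹ b² b³ ds acc < n
    loop-< b¹ b² b³ []       acc<n = acc<n
    loop-< b¹ b² b³ (d ∷ ds) _     = loop-< b¹ b² b³ ds (m%n<n _ n)

    square²≡^4 : ∀ a → square (square a) ≡ a ^ 4
    square²≡^4 a = fourth a
      where
      fourth : ∀ a → a * a * (a * a) ≡ a * (a * (a * (a * 1)))
      fourth = solve-∀

    digitPower-≈ : ∀ {b b¹ b² b³} → b¹ ≈ b → b² ≈ b ^ 2 → b³ ≈ b ^ 3 →
                   ∀ d → digitPower b¹ b² b³ d ≈ b ^ toℕ d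
    digitPower-≈     _   _   _   0F = ≈-refl
    digitPower-≈ {b} b¹≈ _   _   1F = ≈-trans b¹≈ (≈-reflexive (sym (*-identityʳ b)))
    digitPower-≈     _   b²≈ _   2F = b²≈
    digitPower-≈     _   _   b³≈ 3F = b³≈

    loop-≈ : ∀ {b b¹ b² b³} → b¹ ≈ b → b² ≈ b ^ 2 → b³ ≈ b ^ 3 →
             ∀ ds {k acc} → acc ≈ b ^ k →
             loop b¹ b² b³ ds acc ≈ b ^ foldl (λ e d → 4 * e + toℕ d) k ds
    loop-≈ _ _ _ [] acc≈ = acc≈
    loop-≈ {b} b¹≈ b²≈ b³≈ (d ∷ ds) {k} {acc} acc≈ =
      loop-≈ b¹≈ b²≈ b³≈ ds (begin
        square (square acc) * t % n    ≈⟨ m%n≈m _ ⟩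
        square (square acc) * t        ≡⟨ cong (_* t) (square²≡^4 acc) ⟩
        acc ^ 4 * t                    ≈⟨ *-cong (^-cong 4 acc≈) (digitPower-≈ b¹≈ b²≈ b³≈ d) ⟩
        (b ^ k) ^ 4 * b ^ toℕ d        ≡⟨ cong (_* b ^ toℕ d) (^-*-assoc b k 4) ⟩
        b ^ (k * 4) * b ^ toℕ d        ≡⟨ cong (λ e → b ^ e * b ^ toℕ d) (*-comm k 4) ⟩
        b ^ (4 * k) * b ^ toℕ d        ≡⟨ ^-distribˡ-+-* b (4 * k) (toℕ d) ⟨
        b ^ (4 * k + toℕ d)            ∎)
      where
      open ≈-Reasoning ≈-setoid
      t = digitPower _ _ _ d

  powMod-< : ∀ ds b → powMod ds b < n
  powMod-< ds b = loop-< _ _ _ ds (m%n<n 1 n)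

  powMod≡^% : ∀ ds b → powMod ds b ≡ b ^ fromBase4 ds % n
  powMod≡^% ds b = ≈⇒≡ (powMod-< ds b) (m%n<n _ n)
    (≈-trans (loop-≈ b¹≈ b²≈ b³≈ ds (m%n≈m 1)) (≈-sym (m%n≈m _)))
    where
    b¹≈ : b % n ≈ b
    b¹≈ = m%n≈m b
    b²≈ : b % n * (b % n) % n ≈ b ^ 2
    b²≈ = ≈-trans (m%n≈m _) (≈-trans (*-cong b¹≈ b¹≈) (≈-reflexive (cong (b *_) (sym (*-identityʳ b)))))
    b³≈ : b % n * (b % n) % n * (b % n) % n ≈ b ^ 3
    b³≈ = ≈-trans (m%n≈m _) (≈-trans (*-cong b²≈ b¹≈) (≈-reflexive (*-comm (b ^ 2) b)))

  powMod-cong : ∀ ds {a b} → a ≈ b → powMod ds a ≡ powMod ds b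
  powMod-cong ds {a} {b} a≈b = begin
    powMod ds a           ≡⟨ powMod≡^% ds a ⟩
    a ^ fromBase4 ds % n  ≡⟨ %-≡ (^-cong (fromBase4 ds) a≈b) ⟩
    b ^ fromBase4 ds % n  ≡⟨ powMod≡^% ds b ⟨
    powMod ds b           ∎
    where open ≡-Reasoning

  powMod-* : ∀ ds a b → powMod ds (a * b) ≈ powMod ds a * powMod ds b
  powMod-* ds a b = begin
    powMod ds (a * b)          ≡⟨ powMod≡^% ds (a * b) ⟩
    (a * b) ^ e % n            ≈⟨ m%n≈m _ ⟩
    (a * b) ^ e                ≡⟨ ^-distribʳ-* a b e ⟩
    a ^ e * b ^ e              ≈⟨ *-cong (m%n≈m _) (m%n≈m _) ⟨
    a ^ e % n * (b ^ e % n)    ≡⟨ cong₂ _*_ (powMod≡^% ds a) (powMod≡^% ds b) ⟨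
    powMod ds a * powMod ds b  ∎
    where
    open ≈-Reasoning ≈-setoid
    e = fromBase4 ds

  powMod-negate : ∀ ds → powMod ds (n ∸ 1) ≡ 1 → ∀ {a b} → a + b ≈ 0 → powMod ds a ≡ powMod ds b
  powMod-negate ds χ[n-1]≡1 {a} {b} a+b≈0 = ≈⇒≡ (powMod-< ds a) (powMod-< ds b) (begin
    χ a              ≡⟨ powMod-cong ds (≈-negate a+b≈0) ⟩
    χ ((n ∸ 1) * b)  ≈⟨ powMod-* ds (n ∸ 1) b ⟩
    χ (n ∸ 1) * χ b  ≡⟨ cong (_* χ b) χ[n-1]≡1 ⟩
    1 * χ b          ≡⟨ *-identityˡ (χ b) ⟩
    χ b              ∎)
    where
    open ≈-Reasoning ≈-setoid
    χ = powMod ds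

  DivisionClosed : (ℕ → Set) → Set
  DivisionClosed H = ∀ {a b z} → H a → H b → z < n → b * z ≈ a → H z

  -- Writing n = q y + r with 0 < q, r < y (possible once y ≥ t > √n) gives χ(q) χ(y) ≈ χ(-r) = χ(r).
  powMod-units-from-small :
    Prime n → ∀ ds → powMod ds (n ∸ 1) ≡ 1 →
    ∀ {H} → DivisionClosed H → ∀ {t} → n < t * t →
    (∀ {y} → y < t → 0 < y → H (powMod ds y)) →
    ∀ y → 0 < y → y < n → H (powMod ds y)
  powMod-units-from-small n-prime ds χ[n-1]≡1 {H} H-div {t} n<t*t small =
    <-rec (λ y → 0 < y → y < n → H (χ y)) step
    where
    χ = powMod ds

    step : ∀ y → (∀ {z} → z < y → 0 < z → z < n → H (χ z)) → 0 < y → y < n → H (χ y)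
    step y rec 0<y y<n with y <? t
    ... | yes y<t = small y<t 0<y
    ... | no  y≮t = H-div (rec r<y 0<r (<-trans r<y y<n)) (rec q<y 0<q (<-trans q<y y<n))
                          (powMod-< ds y) χq*χy≈χr
      where
      instance _ = >-nonZero 0<y
      q = n / y
      r = n % y

      t≤y : t ≤ y
      t≤y = ≮⇒≥ y≮t

      1<y : 1 < y
      1<y with y ≤? 1
      ... | no  y≰1 = ≰⇒> y≰1
      ... | yes y≤1 = contradiction (≤-trans n<t*t (*-mono-≤ t≤1 t≤1)) (≤⇒≯ (>-nonZero⁻¹ n))
        where t≤1 = ≤-trans t≤y y≤1

      0<r : 0 < r
      0<r = n≢0⇒n>0 λ r≡0 → prime⇒rough n-prime
              (hasNonTrivialDivisor ⦃ n>1⇒nonTrivial 1<y ⦄ y<n (m%n≡0⇒n∣m n y r≡0))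

      r<y : r < y
      r<y = m%n<n n y

      0<q : 0 < q
      0<q = m≥n⇒m/n>0 (<⇒≤ y<n)

      q<y : q < y
      q<y = *-cancelʳ-< y q y (≤-<-trans (m/n*n≤m n y) (<-≤-trans n<t*t (*-mono-≤ t≤y t≤y)))

      qy+r≈0 : q * y + r ≈ 0
      qy+r≈0 = ∣⇒≈0 (subst (n ∣_) (trans (m≡m%n+[m/n]*n n y) (+-comm r (q * y))) ∣-refl)

      χq*χy≈χr : χ q * χ y ≈ χ r
      χq*χy≈χr = begin
        χ q * χ y  ≈⟨ powMod-* ds q y ⟨
        χ (q * y)  ≡⟨ powMod-negate ds χ[n-1]≡1 qy+r≈0 ⟩
        χ r        ∎
        where open ≈-Reasoning ≈-setoid

-- Colourings by residue classes modulo a prime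
module ResidueColouring
  (p : ℕ) ⦃ _ : NonZero p ⦄ (p-prime : Prime p)
  {r : ℕ} (c : ℕ → Fin r)
  (c-cong  : ∀ {x y} → p ∤ x → x % p ≡ y % p → c x ≡ c y)
  (c-scale : ∀ {x y z} → p ∤ x → p ∤ y → p ∤ z → c x ≡ c y → c (x * z) ≡ c (y * z))
  (c0≢cp   : c 0 ≢ c p)
  where

  open Modulo p

  record Bichromatic (k u : ℕ) : Set where
    constructor bichromatic
    field
      {x y} : ℕ
      u≤x   : u ≤ x
      x<u+k : x < u + k
      u≤y   : u ≤ y
      y<u+k : y < u + k
      p∤x   : p ∤ x
      p∤y   : p ∤ y
      cx≢cy : c x ≢ c y

  Bichromatic-mirror : (∀ {x y} → p ∤ x → x + y ≡ p → c x ≡ c y) →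
                       ∀ {m u v} → u + m + v ≡ p → Bichromatic (suc m) v → Bichromatic (suc m) u
  Bichromatic-mirror c-reflect {m} {u} {v} u+m+v≡p
    (bichromatic {x} {y} v≤x x<v+k v≤y y<v+k p∤x p∤y cx≢cy) =
    bichromatic (m≤m+n u _) (mirror-< x) (m≤m+n u _) (mirror-< y)
      (p∤mirror v≤x x<v+k p∤x) (p∤mirror v≤y y<v+k p∤y)
      λ c-mx≡c-my → cx≢cy (begin
        c x           ≡⟨ c-reflect (p∤mirror v≤x x<v+k p∤x) (mirror-+ v≤x x<v+k) ⟨
        c (mirror x)  ≡⟨ c-mx≡c-my ⟩
        c (mirror y)  ≡⟨ c-reflect (p∤mirror v≤y y<v+k p∤y) (mirror-+ v≤y y<v+k) ⟩
        c y           ∎)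
    where
    open ≡-Reasoning

    mirror : ℕ → ℕ
    mirror x = u + (m ∸ (x ∸ v))

    mirror-< : ∀ x → mirror x < u + suc m
    mirror-< x = +-monoʳ-< u (s≤s (m∸n≤m m (x ∸ v)))

    regroup : ∀ a b c d → a + b + (c + d) ≡ a + (b + c) + d
    regroup = solve-∀

    mirror-+ : ∀ {x} → v ≤ x → x < v + suc m → mirror x + x ≡ p
    mirror-+ {x} v≤x x<v+k = begin
      u + (m ∸ j) + x        ≡⟨ cong (u + (m ∸ j) +_) (m∸n+n≡m v≤x) ⟨
      u + (m ∸ j) + (j + v)  ≡⟨ regroup u (m ∸ j) j v ⟩
      u + (m ∸ j + j) + v    ≡⟨ cong (λ i → u + i + v) (m∸n+n≡m j≤m) ⟩
      u + m + v              ≡⟨ u+m+v≡p ⟩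
      p                      ∎
      where
      j = x ∸ v
      j≤m : j ≤ m
      j≤m = s≤s⁻¹ (subst (j <_) (m+n∸m≡n v (suc m)) (∸-monoˡ-< x<v+k v≤x))

    p∤mirror : ∀ {x} → v ≤ x → x < v + suc m → p ∤ x → p ∤ mirror x
    p∤mirror v≤x x<v+k p∤x p∣mx =
      p∤x (∣m+n∣m⇒∣n (subst (p ∣_) (sym (mirror-+ v≤x x<v+k)) ∣-refl) p∣mx)

  -- Certified search for bichromatic windows [u, u + m]. Colours of units are compared
  -- through a key κ, which may be cheaper to evaluate than c.
  module Scan (κ : ℕ → ℕ) (κ-resp : ∀ {x y} → p ∤ x → p ∤ y → c x ≡ c y → κ x ≡ κ y) (m : ℕ) where

    isPartner : ℕ → ℕ → Bool
    isPartner x k = not (does (κ x ≟ k)) ∧ not (does (p ∣? x))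

    isPartner-sound : ∀ {x y} → p ∤ y → T (isPartner x (κ y)) → p ∤ x × c x ≢ c y
    isPartner-sound {x} {y} p∤y h with Equivalence.to (T-∧ {not (does (κ x ≟ κ y))}) h
    ... | κx≢κy , p∤x = T-not-does (p ∣? x) p∤x ,
                        T-not-does (κ x ≟ κ y) κx≢κy ∘ κ-resp (T-not-does (p ∣? x) p∤x) p∤y

    -- If the last point s + m of the window at s is a unit, a unit s + i (i < m) of another
    -- colour settles all windows starting in [s, s + i]; the largest such i is tried first.
    mutual
      scan : (fuel s t : ℕ) → Bool
      scan zero       s t = false
      scan (suc fuel) s t =
        if does (t ≤? s) then true
        else if does (p ∣? (s + m)) then false
        else search fuel s t (κ (s + m)) m

      search : (fuel s t k : ℕ) → ℕ → Bool
      search fuel s t k zero    = false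
      search fuel s t k (suc i) =
        if isPartner (s + i) k then scan fuel (suc (s + i)) t
        else search fuel s t k i

    mutual
      scan-sound : ∀ fuel s t → T (scan fuel s t) → ∀ u → s ≤ u → u < t → Bichromatic (suc m) u
      scan-sound zero s t () u s≤u u<t
      scan-sound (suc fuel) s t h u s≤u u<t with T-if (does (t ≤? s)) h
      ... | inj₁ (t≤s , _) = contradiction (≤-trans (T-does (t ≤? s) t≤s) s≤u) (<⇒≱ u<t)
      ... | inj₂ (_ , h) with T-if (does (p ∣? (s + m))) h
      ...   | inj₁ (_ , ())
      ...   | inj₂ (p∤last , h) =
        search-sound fuel s t m ≤-refl (T-not-does (p ∣? (s + m)) p∤last) h u s≤u u<t

      search-sound : ∀ fuel s t i → i ≤ m → p ∤ s + m → T (search fuel s t (κ (s + m)) i) →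
                     ∀ u → s ≤ u → u < t → Bichromatic (suc m) u
      search-sound fuel s t zero i≤m p∤last () u s≤u u<t
      search-sound fuel s t (suc i) i<m p∤last h u s≤u u<t
        with T-if (isPartner (s + i) (κ (s + m))) h
      ... | inj₂ (_ , h) = search-sound fuel s t i (<⇒≤ i<m) p∤last h u s≤u u<t
      ... | inj₁ (partner , h) with u ≤? s + i
      ...   | no  u≰s+i = scan-sound fuel (suc (s + i)) t h u (≰⇒> u≰s+i) u<t
      ...   | yes u≤s+i =
        bichromatic u≤s+i (≤-<-trans (+-monoʳ-≤ s (<⇒≤ i<m)) last<)
                    (≤-trans u≤s+i (+-monoʳ-≤ s (<⇒≤ i<m))) last<
                    (proj₁ (isPartner-sound p∤last partner)) p∤last (proj₂ (isPartner-sound p∤last partner))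
        where
        last< : s + m < u + suc m
        last< = +-mono-≤-< s≤u (n<1+n m)

  module _ {m : ℕ} (windows : ∀ u → u < p → Bichromatic (2 + m) u) where

    no-monochromatic-progression :
      ∀ {a d col} → 1 ≤ d → a + suc m * d ≤ suc m * p →
      (∀ {j} → j < 2 + m → c (a + j * d) ≡ col) → ⊥
    no-monochromatic-progression {a} {d} {col} 1≤d last≤ term with p ∣? d
    ... | yes p∣d = c0≢cp (begin
      c 0            ≡⟨ cong c (trans (+-identityʳ a) a≡0) ⟨
      c (a + 0 * d)  ≡⟨ term (s≤s z≤n) ⟩
      col            ≡⟨ term (s≤s (s≤s z≤n)) ⟨
      c (a + 1 * d)  ≡⟨ cong c (cong₂ _+_ a≡0 (trans (*-identityˡ d) d≡p)) ⟩
      c p            ∎)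
      where
      open ≡-Reasoning
      a≡0×d≡p = progression-squeeze m last≤ (∣⇒≤ ⦃ >-nonZero 1≤d ⦄ p∣d)
      a≡0 = proj₁ a≡0×d≡p
      d≡p = proj₂ a≡0×d≡p
    ... | no p∤d = cx≢cy cx≡cy
      where
      e = proj₁ (∤⇒∃-inverse p-prime p∤d)
      de≈1 = proj₂ (∤⇒∃-inverse p-prime p∤d)
      u = a * e % p
      open Bichromatic (windows u (m%n<n (a * e) p))

      p∤e : p ∤ e
      p∤e p∣e = ¬prime[1] (subst Prime (∣1⇒≡1 (∣-resp-≈ de≈1 (∣n⇒∣m*n d p∣e))) p-prime)

      -- The term of the progression that d⁻¹ sends to z.
      term-at : ℕ → ℕ
      term-at z = a + (z ∸ u) * d

      index< : ∀ {z} → u ≤ z → z < u + (2 + m) → z ∸ u < 2 + m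
      index< {z} u≤z z<u+k = subst (z ∸ u <_) (m+n∸m≡n u (2 + m)) (∸-monoˡ-< z<u+k u≤z)

      scaled : ∀ {z} → u ≤ z → p ∤ z → p ∤ term-at z × c (term-at z * e) ≡ c z
      scaled {z} u≤z p∤z = p∤t , sym (c-cong p∤z (%-≡ (≈-sym te≈z)))
        where
        j = z ∸ u
        te≈z : term-at z * e ≈ z
        te≈z = begin
          (a + j * d) * e      ≡⟨ *-distribʳ-+ e a (j * d) ⟩
          a * e + j * d * e    ≡⟨ cong (a * e +_) (*-assoc j d e) ⟩
          a * e + j * (d * e)  ≈⟨ +-cong (≈-sym (m%n≈m (a * e))) (*-cong (≈-refl {j}) de≈1) ⟩
          u + j * 1            ≡⟨ cong (u +_) (*-identityʳ j) ⟩
          u + j                ≡⟨ m+[n∸m]≡n u≤z ⟩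
          z                    ∎
          where open ≈-Reasoning ≈-setoid
        p∤t : p ∤ term-at z
        p∤t p∣t = p∤z (∣-resp-≈ te≈z (∣m⇒∣m*n e p∣t))

      cx≡cy : c x ≡ c y
      cx≡cy = begin
        c x                ≡⟨ proj₂ (scaled u≤x p∤x) ⟨
        c (term-at x * e)  ≡⟨ c-scale (proj₁ (scaled u≤x p∤x)) (proj₁ (scaled u≤y p∤y)) p∤e
                                (trans (term (index< u≤x x<u+k)) (sym (term (index< u≤y y<u+k)))) ⟩
        c (term-at y * e)  ≡⟨ proj₂ (scaled u≤y p∤y) ⟩
        c y                ∎
        where open ≡-Reasoning

    colouring : Coloring (1 + suc m * p) r
    colouring i = c (toℕ i)

    no-monochromatic-AP : ¬ MonoAP colouring (2 + m)
    no-monochromatic-AP (a , d , 1≤d , col , term) =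
      no-monochromatic-progression 1≤d (s≤s⁻¹ (proj₁ (term-at (n<1+n (suc m))))) (proj₂ ∘ term-at)
      where
      term-at : ∀ {j} → j < 2 + m → a + j * d < 1 + suc m * p × c (a + j * d) ≡ col
      term-at {j} j<k with term (fromℕ< j<k)
      ... | lt , eq = subst (λ i → a + i * d < 1 + suc m * p) toℕj≡j lt ,
                      trans (cong c (sym (trans (toℕ-fromℕ< lt) (cong (λ i → a + i * d) toℕj≡j)))) eq
        where toℕj≡j = toℕ-fromℕ< j<k

    windows⇒WGreater : WGreater (2 + m) r (1 + suc m * p)
    windows⇒WGreater = colouring , no-monochromatic-AP

-- The prime and its cubic character
opaque
  p : ℕ
  p = 51481237

opaque
  unfolding p

  instance
    p-nonZero : NonZero p
    p-nonZero = _

  p-prime : Prime p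
  p-prime = rough∧square>⇒prime
    (trialDivision⇒rough (from-yes (allUpTo? (λ d → nonTrivial? d →-dec ¬? (d ∣? p)) 7176)))
    (from-yes (p <? 7176 * 7176))

open Modulo p

-- (p - 1) / 3 = 17160412 = 1001131203130 in base 4.
opaque
  cubicDigits : List (Fin 4)
  cubicDigits = 1F ∷ 0F ∷ 0F ∷ 1F ∷ 1F ∷ 3F ∷ 1F ∷ 2F ∷ 0F ∷ 3F ∷ 1F ∷ 3F ∷ 0F ∷ []

χ : ℕ → ℕ
χ = powMod cubicDigits

-- 1, χ 2 and χ 4.
cubeRoots : List ℕ
cubeRoots = 1 ∷ 13514948 ∷ 37966288 ∷ []

cubicClass : ℕ → Fin 3
cubicClass v = if v ≡ᵇ 13514948 then 1F else if v ≡ᵇ 37966288 then 2F else 0F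

cubicClass-inverse : ∀ {v} → v ∈ cubeRoots → lookup cubeRoots (cubicClass v) ≡ v
cubicClass-inverse (here refl)                 = refl
cubicClass-inverse (there (here refl))         = refl
cubicClass-inverse (there (there (here refl))) = refl

cubicClass-injective : ∀ {v w} → v ∈ cubeRoots → w ∈ cubeRoots → cubicClass v ≡ cubicClass w → v ≡ w
cubicClass-injective v∈ w∈ eq =
  trans (sym (cubicClass-inverse v∈)) (trans (cong (lookup cubeRoots) eq) (cubicClass-inverse w∈))

opaque
  unfolding p cubicDigits

  χ[p-1]≡1 : χ (p ∸ 1) ≡ 1
  χ[p-1]≡1 = refl

  p<7176² : p < 7176 * 7176
  p<7176² = from-yes (p <? 7176 * 7176)

  cubeRoots-cube : All (λ b → b * b * b ≈ 1) cubeRoots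
  cubeRoots-cube = from-yes (all? (λ b → b * b * b ≈? 1) cubeRoots)

  cubeRoots-closed : All (λ a → All (λ b → a * b * b % p ∈ cubeRoots) cubeRoots) cubeRoots
  cubeRoots-closed = from-yes (all? (λ a → all? (λ b → a * b * b % p ∈? cubeRoots) cubeRoots) cubeRoots)

  χ-small : ∀ {y} → y < 7176 → 0 < y → χ y ∈ cubeRoots
  χ-small = from-yes (allUpTo? (λ y → 0 <? y →-dec χ y ∈? cubeRoots) 7176)

cubeRoots-divisionClosed : DivisionClosed (_∈ cubeRoots)
cubeRoots-divisionClosed {a} {b} {z} a∈ b∈ z<p bz≈a =
  subst (_∈ cubeRoots) (sym z≡abb) (All.lookup (All.lookup cubeRoots-closed a∈) b∈)
  where
  rearrange : ∀ z b → z * (b * b * b) ≡ b * z * b * b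
  rearrange = solve-∀

  z≡abb : z ≡ a * b * b % p
  z≡abb = ≈⇒≡ z<p (m%n<n _ p) (begin
    z                ≡⟨ *-identityʳ z ⟨
    z * 1            ≈⟨ *-cong (≈-refl {z}) (All.lookup cubeRoots-cube b∈) ⟨
    z * (b * b * b)  ≡⟨ rearrange z b ⟩
    b * z * b * b    ≈⟨ *-cong (*-cong bz≈a (≈-refl {b})) (≈-refl {b}) ⟩
    a * b * b        ≈⟨ m%n≈m _ ⟨
    a * b * b % p    ∎)
    where open ≈-Reasoning ≈-setoid

χ-units : ∀ {x} → p ∤ x → χ x ∈ cubeRoots
χ-units {x} p∤x = subst (_∈ cubeRoots) (powMod-cong cubicDigits (m%n≈m x))
  (powMod-units-from-small p-prime cubicDigits χ[p-1]≡1 cubeRoots-divisionClosed p<7176² χ-small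
    (x % p) (n≢0⇒n>0 (p∤x ∘ m%n≡0⇒n∣m x p)) (m%n<n x p))

colour : ℕ → Fin 3
colour x = if does (p ∣? x) then (if x ≡ᵇ 0 then 0F else 1F) else cubicClass (χ x)

colour-unit : ∀ {x} → p ∤ x → colour x ≡ cubicClass (χ x)
colour-unit {x} p∤x with p ∣? x
... | yes p∣x = contradiction p∣x p∤x
... | no  _   = refl

colour-cong : ∀ {x y} → p ∤ x → x % p ≡ y % p → colour x ≡ colour y
colour-cong {x} {y} p∤x x%p≡y%p = begin
  colour x          ≡⟨ colour-unit p∤x ⟩
  cubicClass (χ x)  ≡⟨ cong cubicClass (powMod-cong cubicDigits (mod-≡ x%p≡y%p)) ⟩
  cubicClass (χ y)  ≡⟨ colour-unit (p∤x ∘ ∣-resp-≈ (mod-≡ (sym x%p≡y%p))) ⟨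
  colour y          ∎
  where open ≡-Reasoning

colour≡⇒χ≡ : ∀ {x y} → p ∤ x → p ∤ y → colour x ≡ colour y → χ x ≡ χ y
colour≡⇒χ≡ p∤x p∤y cx≡cy = cubicClass-injective (χ-units p∤x) (χ-units p∤y)
  (trans (sym (colour-unit p∤x)) (trans cx≡cy (colour-unit p∤y)))

colour-scale : ∀ {x y z} → p ∤ x → p ∤ y → p ∤ z → colour x ≡ colour y → colour (x * z) ≡ colour (y * z)
colour-scale {x} {y} {z} p∤x p∤y p∤z cx≡cy = begin
  colour (x * z)          ≡⟨ colour-unit (p∤product p∤x) ⟩
  cubicClass (χ (x * z))  ≡⟨ cong cubicClass χxz≡χyz ⟩
  cubicClass (χ (y * z))  ≡⟨ colour-unit (p∤product p∤y) ⟨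
  colour (y * z)          ∎
  where
  open ≡-Reasoning

  p∤product : ∀ {w} → p ∤ w → p ∤ w * z
  p∤product {w} p∤w p∣wz with euclidsLemma w z p-prime p∣wz
  ... | inj₁ p∣w = p∤w p∣w
  ... | inj₂ p∣z = p∤z p∣z

  χxz≡χyz : χ (x * z) ≡ χ (y * z)
  χxz≡χyz = ≈⇒≡ (powMod-< cubicDigits _) (powMod-< cubicDigits _)
    (≈-trans (powMod-* cubicDigits x z)
    (≈-trans (≈-reflexive (cong (_* χ z) (colour≡⇒χ≡ p∤x p∤y cx≡cy))) (≈-sym (powMod-* cubicDigits y z))))

colour-reflect : ∀ {x y} → p ∤ x → x + y ≡ p → colour x ≡ colour y
colour-reflect {x} {y} p∤x x+y≡p = begin
  colour x          ≡⟨ colour-unit p∤x ⟩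
  cubicClass (χ x)  ≡⟨ cong cubicClass (powMod-negate cubicDigits χ[p-1]≡1 x+y≈0) ⟩
  cubicClass (χ y)  ≡⟨ colour-unit p∤y ⟨
  colour y          ∎
  where
  open ≡-Reasoning
  x+y≈0 : x + y ≈ 0
  x+y≈0 = ∣⇒≈0 (subst (p ∣_) (sym x+y≡p) ∣-refl)
  p∤y : p ∤ y
  p∤y p∣y = p∤x (∣m+n∣m⇒∣n (subst (p ∣_) (trans (sym x+y≡p) (+-comm x y)) ∣-refl) p∣y)

opaque
  unfolding p cubicDigits

  colour0≢colourp : colour 0 ≢ colour p
  colour0≢colourp ()

open ResidueColouring p p-prime colour colour-cong colour-scale colour0≢colourp
open Scan χ colour≡⇒χ≡ 13

-- Windows of 14 consecutive residues
half : ℕ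
half = 25740613

opaque
  unfolding p cubicDigits

  scan-lower-half : scan (suc half) 0 half ≡ true
  scan-lower-half = refl

  upper-half-mirrored : p ∸ (half + 13) < half
  upper-half-mirrored = from-yes (p ∸ (half + 13) <? half)

  p∤p-2 : p ∤ p ∸ 2
  p∤p-2 = from-no (p ∣? (p ∸ 2))

  p∤p-1 : p ∤ p ∸ 1
  p∤p-1 = from-no (p ∣? (p ∸ 1))

  colour[p-2]≢colour[p-1] : colour (p ∸ 2) ≢ colour (p ∸ 1)
  colour[p-2]≢colour[p-1] ()

  2≤p : 2 ≤ p
  2≤p = from-yes (2 ≤? p)

  last-window : Bichromatic 14 (p ∸ 1)
  last-window = bichromatic {x = p + 1} {y = p + 2}
    (from-yes (p ∸ 1 ≤? p + 1)) (from-yes (p + 1 <? p ∸ 1 + 14))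
    (from-yes (p ∸ 1 ≤? p + 2)) (from-yes (p + 2 <? p ∸ 1 + 14))
    (from-no (p ∣? (p + 1))) (from-no (p ∣? (p + 2))) λ ()

lower-windows : ∀ u → u < half → Bichromatic 14 u
lower-windows u = scan-sound (suc half) 0 half (Equivalence.from T-≡ scan-lower-half) u z≤n

below-or-last : ∀ {u} → u < p → u ≤ p ∸ 2 ⊎ u ≡ p ∸ 1
below-or-last {u} u<p with u ≤? p ∸ 2
... | yes u≤p-2 = inj₁ u≤p-2
... | no  u≰p-2 = inj₂ (≤-antisym (∸-monoˡ-≤ 1 u<p) (subst (_≤ u) (sym (+-∸-assoc 1 2≤p)) (≰⇒> u≰p-2)))

-- The case splits below avoid with-abstraction, which would normalise the goal Bichromatic 14 u
-- together with the proofs that ResidueColouring was instantiated with.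
wrapping-windows : ∀ u → u < p → p < u + 13 → Bichromatic 14 u
wrapping-windows u u<p p<u+13 =
  [ through-p-1 , (λ u≡p-1 → subst (Bichromatic 14) (sym u≡p-1) last-window) ]′ (below-or-last u<p)
  where
  p<u+14 : p < u + 14
  p<u+14 = <-trans p<u+13 (+-monoʳ-< u (n<1+n 13))

  through-p-1 : u ≤ p ∸ 2 → Bichromatic 14 u
  through-p-1 u≤p-2 =
    bichromatic u≤p-2 (≤-<-trans (m∸n≤m p 2) p<u+14) (≤-trans u≤p-2 (∸-monoʳ-≤ p (s≤s z≤n)))
                (≤-<-trans (m∸n≤m p 1) p<u+14) p∤p-2 p∤p-1 colour[p-2]≢colour[p-1]

mirrored-windows : ∀ u → half ≤ u → u + 13 ≤ p → Bichromatic 14 u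
mirrored-windows u half≤u u+13≤p =
  Bichromatic-mirror colour-reflect (m+[n∸m]≡n u+13≤p)
    (lower-windows (p ∸ (u + 13)) (≤-<-trans (∸-monoʳ-≤ p (+-monoˡ-≤ 13 half≤u)) upper-half-mirrored))

all-windows : ∀ u → u < p → Bichromatic 14 u
all-windows u u<p =
  [ lower-windows u
  , (λ half≤u → [ mirrored-windows u half≤u , wrapping-windows u u<p ]′ (≤-<-connex (u + 13) p))
  ]′ (<-≤-connex u half)

opaque
  unfolding p

  size≡ : 1 + 13 * p ≡ 669256082
  size≡ = refl

mainTheorem2 : WGreater 14 3 669256082
mainTheorem2 = subst (WGreater 14 3) size≡ (windows⇒WGreater all-windows)
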